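{- Two $B$-terms are $\beta\eta$-equivalent if and only if their equality is derivable (in equational logic, i.e. using reflexivity, symmetry, transitivity, congruence with respect to application, and instantiation of the variables $x,y,z$ by arbitrary $B$-terms) from the following three equations: \[ B\,x\,y\,z = x\,(y\,z) \quad\text{(B1)},\qquad B\,(B\,x\,y) = B\,(B\,x)\,(B\,y) \quad\text{(B2)},\qquad B\,B\,(B\,x) = B\,(B\,(B\,x))\,B \quad\text{(B3)}. \]
   Context: $B$ denotes the combinator $\lambda f.\lambda g.\lambda x.\, f\,(g\,x)$. A $B$-term is a combinatory term built from the constant $B$ alone by application (application is left-associative). Two $B$-terms are called equivalent ($\beta\eta$-equivalent) if the $\lambda$-terms obtained by replacing each $B$ by $\lambda f.\lambda g.\lambda x.\, f\,(g\,x)$ are $\beta\eta$-equivalent. -}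

module Defs where

open import Data.Nat using (ℕ; zero; suc)

infixl 9 _·_

data BTerm : Set where
  B   : BTerm
  _·_ : BTerm → BTerm → BTerm

data Λ : Set where
  var : ℕ → Λ
  app : Λ → Λ → Λ
  lam : Λ → Λ

ext : (ℕ → ℕ) → ℕ → ℕ
ext ρ zero    = zero
ext ρ (suc n) = suc (ρ n)

rename : (ℕ → ℕ) → Λ → Λ
rename ρ (var n)   = var (ρ n)
rename ρ (app M N) = app (rename ρ M) (rename ρ N)
rename ρ (lam M)   = lam (rename (ext ρ) M)

exts : (ℕ → Λ) → ℕ → Λ
exts σ zero    = var zero
exts σ (suc n) = rename suc (σ n)

sub : (ℕ → Λ) → Λ → Λ
sub σ (var n)   = σ n
sub σ (app M N) = app (sub σ M) (sub σ N)
sub σ (lam M)   = lam (sub (exts σ) M)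

sub0 : Λ → ℕ → Λ
sub0 N zero    = N
sub0 N (suc n) = var n

_[_] : Λ → Λ → Λ
M [ N ] = sub (sub0 N) M

infix 4 _=βη_
data _=βη_ : Λ → Λ → Set where
  β     : ∀ M N → app (lam M) N =βη M [ N ]
  η     : ∀ M → lam (app (rename suc M) (var zero)) =βη M
  refl  : ∀ {M} → M =βη M
  sym   : ∀ {M N} → M =βη N → N =βη M
  trans : ∀ {M N P} → M =βη N → N =βη P → M =βη P
  appC  : ∀ {M M' N N'} → M =βη M' → N =βη N' → app M N =βη app M' N'
  lamC  : ∀ {M M'} → M =βη M' → lam M =βη lam M'

-- Translation: replace each B by λf.λg.λx. f (g x)

Bλ : Λ
Bλ = lam (lam (lam (app (var 2) (app (var 1) (var 0)))))

⟦_⟧ : BTerm → Λ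
⟦ B ⟧     = Bλ
⟦ t · u ⟧ = app ⟦ t ⟧ ⟦ u ⟧

_≈βη_ : BTerm → BTerm → Set
t ≈βη u = ⟦ t ⟧ =βη ⟦ u ⟧

infix 4 ⊢B_≐_
data ⊢B_≐_ : BTerm → BTerm → Set where
  B1    : ∀ x y z → ⊢B B · x · y · z ≐ x · (y · z)
  B2    : ∀ x y → ⊢B B · (B · x · y) ≐ B · (B · x) · (B · y)
  B3    : ∀ x → ⊢B B · B · (B · x) ≐ B · (B · (B · x)) · B
  refl  : ∀ {t} → ⊢B t ≐ t
  sym   : ∀ {t u} → ⊢B t ≐ u → ⊢B u ≐ t
  trans : ∀ {t u v} → ⊢B t ≐ u → ⊢B u ≐ v → ⊢B t ≐ v
  appC  : ∀ {t t' u u'} → ⊢B t ≐ t' → ⊢B u ≐ u' → ⊢B t · u ≐ t' · u'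

-- Soundness: after applying both sides to fresh variables, each equation is a β-computation,
-- so η closes it. Completeness: writing B[ n ] for B · (B · … B), the equations (B1) and (B2)
-- rewrite every B-term into a composite of B[ n ]'s, and (B2) with (B3) give the relation
-- B[ i ] ∘ B[ j ] = B[ j + 1 ] ∘ B[ i ] (i < j) of Thompson's monoid, which sorts such a
-- composite. A sorted composite applied to variables rearranges them, by merging neighbours,
-- into a λ-free term from which the composite can be read back; by the Church–Rosser theorem
-- for βη, βη-equal λ-free terms are identical, so βη-equal B-terms have the same sorted
-- normal form.
module Submission where

open import Data.Empty using (⊥-elim)
open import Data.List using (List; []; _∷_; length; foldl; take; replicate)
open import Data.List.Properties using (length-replicate; ∷-injective)
open import Data.List.Relation.Unary.All as All using (All; []; _∷_)
open import Data.List.Relation.Unary.All.Properties using (take⁺; replicate⁺)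
open import Data.List.Relation.Unary.AllPairs using (AllPairs; []; _∷_)
open import Data.Nat using (ℕ; zero; suc; pred; _+_; _≤_; _<_; s≤s; z≤n; _<?_)
open import Data.Nat.Properties
  using (≤-trans; ≤-pred; <⇒≤; ≮⇒≥; m≤n⇒m≤1+n; <-cmp; +-assoc; +-suc; +-identityʳ; +-monoˡ-≤;
         m≤m+n; m≤n+m; m+n≤o⇒m≤o; m≢1+m+n; module ≤-Reasoning)
open import Data.Product using (∃-syntax; _×_; _,_; proj₁; proj₂)
open import Data.Sum using (_⊎_; inj₁; inj₂)
open import Data.Unit using (⊤; tt)
open import Function using (_∘_; id)
open import Function.Bundles using (_⇔_; mk⇔)
open import Relation.Binary using (Rel; Setoid; tri<; tri≈; tri>)
open import Relation.Binary.Construct.Closure.ReflexiveTransitive using (Star; ε; _◅_; _◅◅_; gmap)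
open import Relation.Binary.PropositionalEquality as ≡ using (_≡_; refl; cong; cong₂; subst; subst₂; _≗_)
open import Relation.Binary.Rewriting using (Confluent)
import Relation.Binary.Reasoning.Setoid
open import Relation.Nullary using (¬_; yes; no)

open import Defs

ext-cong : ∀ {ρ ρ′} → ρ ≗ ρ′ → ext ρ ≗ ext ρ′
ext-cong h zero    = refl
ext-cong h (suc n) = cong suc (h n)

rename-cong : ∀ {ρ ρ′} → ρ ≗ ρ′ → rename ρ ≗ rename ρ′
rename-cong h (var n)   = cong var (h n)
rename-cong h (app M N) = cong₂ app (rename-cong h M) (rename-cong h N)
rename-cong h (lam M)   = cong lam (rename-cong (ext-cong h) M)

rename-∘ : ∀ ρ ρ′ M → rename ρ (rename ρ′ M) ≡ rename (ρ ∘ ρ′) M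
rename-∘ ρ ρ′ (var n)   = refl
rename-∘ ρ ρ′ (app M N) = cong₂ app (rename-∘ ρ ρ′ M) (rename-∘ ρ ρ′ N)
rename-∘ ρ ρ′ (lam M)   = cong lam (≡.trans (rename-∘ (ext ρ) (ext ρ′) M)
  (rename-cong (λ { zero → refl ; (suc n) → refl }) M))

exts-cong : ∀ {σ τ} → σ ≗ τ → exts σ ≗ exts τ
exts-cong h zero    = refl
exts-cong h (suc n) = cong (rename suc) (h n)

sub-cong : ∀ {σ τ} → σ ≗ τ → sub σ ≗ sub τ
sub-cong h (var n)   = h n
sub-cong h (app M N) = cong₂ app (sub-cong h M) (sub-cong h N)
sub-cong h (lam M)   = cong lam (sub-cong (exts-cong h) M)

sub-rename : ∀ σ ρ M → sub σ (rename ρ M) ≡ sub (σ ∘ ρ) M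
sub-rename σ ρ (var n)   = refl
sub-rename σ ρ (app M N) = cong₂ app (sub-rename σ ρ M) (sub-rename σ ρ N)
sub-rename σ ρ (lam M)   = cong lam (≡.trans (sub-rename (exts σ) (ext ρ) M)
  (sub-cong (λ { zero → refl ; (suc n) → refl }) M))

rename-sub : ∀ ρ σ M → rename ρ (sub σ M) ≡ sub (rename ρ ∘ σ) M
rename-sub ρ σ (var n)   = refl
rename-sub ρ σ (app M N) = cong₂ app (rename-sub ρ σ M) (rename-sub ρ σ N)
rename-sub ρ σ (lam M)   = cong lam (≡.trans (rename-sub (ext ρ) (exts σ) M)
  (sub-cong (λ { zero → refl
               ; (suc n) → ≡.trans (rename-∘ (ext ρ) suc (σ n)) (≡.sym (rename-∘ suc ρ (σ n))) }) M))

sub-sub : ∀ τ σ M → sub τ (sub σ M) ≡ sub (sub τ ∘ σ) M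
sub-sub τ σ (var n)   = refl
sub-sub τ σ (app M N) = cong₂ app (sub-sub τ σ M) (sub-sub τ σ N)
sub-sub τ σ (lam M)   = cong lam (≡.trans (sub-sub (exts τ) (exts σ) M)
  (sub-cong (λ { zero → refl
               ; (suc n) → ≡.trans (sub-rename (exts τ) suc (σ n)) (≡.sym (rename-sub suc τ (σ n))) }) M))

sub-var : ∀ {σ} → σ ≗ var → sub σ ≗ id
sub-var h (var n)   = h n
sub-var h (app M N) = cong₂ app (sub-var h M) (sub-var h N)
sub-var h (lam M)   = cong lam (sub-var (λ { zero → refl ; (suc n) → cong (rename suc) (h n) }) M)

sub-weaken : ∀ σ M → sub (exts σ) (rename suc M) ≡ rename suc (sub σ M)
sub-weaken σ M = ≡.trans (sub-rename (exts σ) suc M) (≡.sym (rename-sub suc σ M))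

rename-weaken : ∀ ρ M → rename (ext ρ) (rename suc M) ≡ rename suc (rename ρ M)
rename-weaken ρ M = ≡.trans (rename-∘ (ext ρ) suc M) (≡.sym (rename-∘ suc ρ M))

weaken-[] : ∀ M N → rename suc M [ N ] ≡ M
weaken-[] M N = ≡.trans (sub-rename (sub0 N) suc M) (sub-var (λ _ → refl) M)

rename-[] : ∀ ρ M N → rename ρ (M [ N ]) ≡ rename (ext ρ) M [ rename ρ N ]
rename-[] ρ M N = ≡.trans (rename-sub ρ (sub0 N) M) (≡.trans
  (sub-cong (λ { zero → refl ; (suc n) → refl }) M) (≡.sym (sub-rename (sub0 (rename ρ N)) (ext ρ) M)))

sub-[] : ∀ σ M N → sub σ (M [ N ]) ≡ sub (exts σ) M [ sub σ N ]
sub-[] σ M N = ≡.trans (sub-sub σ (sub0 N) M) (≡.trans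
  (sub-cong (λ { zero → refl ; (suc n) → ≡.sym (weaken-[] (σ n) (sub σ N)) }) M)
  (≡.sym (sub-sub (sub0 (sub σ N)) (exts σ) M)))

rename-ext-suc-[var0] : ∀ M → rename (ext suc) M [ var zero ] ≡ M
rename-ext-suc-[var0] M = ≡.trans (sub-rename (sub0 (var zero)) (ext suc) M)
  (sub-var (λ { zero → refl ; (suc n) → refl }) M)

rename-suc-injective : ∀ {M N} → rename suc M ≡ rename suc N → M ≡ N
rename-suc-injective {M} {N} e =
  ≡.trans (≡.sym (unweaken M)) (≡.trans (cong (sub (var ∘ pred)) e) (unweaken N))
  where
  unweaken : ∀ M → sub (var ∘ pred) (rename suc M) ≡ M
  unweaken M = ≡.trans (sub-rename (var ∘ pred) suc M) (sub-var (λ _ → refl) M)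

var-injective : ∀ {m n} → var m ≡ var n → m ≡ n
var-injective refl = refl

app-injective : ∀ {M M′ N N′} → app M N ≡ app M′ N′ → M ≡ M′ × N ≡ N′
app-injective refl = refl , refl

lam-injective : ∀ {M M′} → lam M ≡ lam M′ → M ≡ M′
lam-injective refl = refl

liftⁿ : ℕ → (ℕ → ℕ) → ℕ → ℕ
liftⁿ zero    ρ = ρ
liftⁿ (suc k) ρ = ext (liftⁿ k ρ)

-- The square  ext ρ ∘ suc = suc ∘ ρ  is a pullback, also under binders.
liftⁿ-pullback : ∀ k ρ n m → liftⁿ k (ext ρ) n ≡ liftⁿ k suc m →
                 ∃[ n′ ] n ≡ liftⁿ k suc n′ × m ≡ liftⁿ k ρ n′
liftⁿ-pullback zero    ρ (suc n) m       refl = n , refl , refl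
liftⁿ-pullback (suc k) ρ zero    zero    e    = zero , refl , refl
liftⁿ-pullback (suc k) ρ (suc n) (suc m) e with liftⁿ-pullback k ρ n m (cong pred e)
... | n′ , refl , refl = suc n′ , refl , refl

rename-pullback : ∀ k ρ M L → rename (liftⁿ k (ext ρ)) M ≡ rename (liftⁿ k suc) L →
                  ∃[ M′ ] M ≡ rename (liftⁿ k suc) M′ × L ≡ rename (liftⁿ k ρ) M′
rename-pullback k ρ (var n) (var m) e with liftⁿ-pullback k ρ n m (var-injective e)
... | n′ , refl , refl = var n′ , refl , refl
rename-pullback k ρ (app M N) (app L L′) e
  with rename-pullback k ρ M L (app-injective e .proj₁)
     | rename-pullback k ρ N L′ (app-injective e .proj₂)
... | M′ , refl , refl | N′ , refl , refl = app M′ N′ , refl , refl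
rename-pullback k ρ (lam M) (lam L) e with rename-pullback (suc k) ρ M L (lam-injective e)
... | M′ , refl , refl = lam M′ , refl , refl

-- Church–Rosser for βη

infix 4 _⇛β_
data _⇛β_ : Λ → Λ → Set where
  pvar  : ∀ {n} → var n ⇛β var n
  plam  : ∀ {M M′} → M ⇛β M′ → lam M ⇛β lam M′
  papp  : ∀ {M M′ N N′} → M ⇛β M′ → N ⇛β N′ → app M N ⇛β app M′ N′
  pbeta : ∀ {M M′ N N′} → M ⇛β M′ → N ⇛β N′ → app (lam M) N ⇛β M′ [ N′ ]

⇛β-refl : ∀ M → M ⇛β M
⇛β-refl (var n)   = pvar
⇛β-refl (app M N) = papp (⇛β-refl M) (⇛β-refl N)
⇛β-refl (lam M)   = plam (⇛β-refl M)

⇛β-rename : ∀ ρ {M M′} → M ⇛β M′ → rename ρ M ⇛β rename ρ M′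
⇛β-rename ρ pvar       = pvar
⇛β-rename ρ (plam d)   = plam (⇛β-rename (ext ρ) d)
⇛β-rename ρ (papp d e) = papp (⇛β-rename ρ d) (⇛β-rename ρ e)
⇛β-rename ρ (pbeta {M′ = M′} {N′ = N′} d e) =
  subst (_ ⇛β_) (≡.sym (rename-[] ρ M′ N′)) (pbeta (⇛β-rename (ext ρ) d) (⇛β-rename ρ e))

⇛β-exts : ∀ {σ τ} → (∀ n → σ n ⇛β τ n) → ∀ n → exts σ n ⇛β exts τ n
⇛β-exts h zero    = pvar
⇛β-exts h (suc n) = ⇛β-rename suc (h n)

⇛β-sub : ∀ {σ τ} → (∀ n → σ n ⇛β τ n) → ∀ {M M′} → M ⇛β M′ → sub σ M ⇛β sub τ M′
⇛β-sub h pvar       = h _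
⇛β-sub h (plam d)   = plam (⇛β-sub (⇛β-exts h) d)
⇛β-sub h (papp d e) = papp (⇛β-sub h d) (⇛β-sub h e)
⇛β-sub {τ = τ} h (pbeta {M′ = M′} {N′ = N′} d e) =
  subst (_ ⇛β_) (≡.sym (sub-[] τ M′ N′)) (pbeta (⇛β-sub (⇛β-exts h) d) (⇛β-sub h e))

⇛β-[] : ∀ {M M′ N N′} → M ⇛β M′ → N ⇛β N′ → M [ N ] ⇛β M′ [ N′ ]
⇛β-[] d e = ⇛β-sub (λ { zero → e ; (suc n) → pvar }) d

-- Takahashi's complete development.
develop : Λ → Λ
develop (var n)         = var n
develop (lam M)         = lam (develop M)
develop (app (lam M) N) = develop M [ develop N ]
develop (app M N)       = app (develop M) (develop N)

⇛β-develop : ∀ {M P} → M ⇛β P → P ⇛β develop M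
⇛β-develop pvar                          = pvar
⇛β-develop (plam d)                      = plam (⇛β-develop d)
⇛β-develop (papp {M = var n} d e)        = papp (⇛β-develop d) (⇛β-develop e)
⇛β-develop (papp {M = app _ _} d e)      = papp (⇛β-develop d) (⇛β-develop e)
⇛β-develop (papp {M = lam _} (plam d) e) = pbeta (⇛β-develop d) (⇛β-develop e)
⇛β-develop (pbeta d e)                   = ⇛β-[] (⇛β-develop d) (⇛β-develop e)

⇛β-rename-inversion : ∀ {ρ M N P} → N ⇛β P → N ≡ rename ρ M →
                      ∃[ M′ ] P ≡ rename ρ M′ × M ⇛β M′
⇛β-rename-inversion {M = var n} pvar refl = var n , refl , pvar
⇛β-rename-inversion {M = lam M} (plam d) refl with ⇛β-rename-inversion d refl
... | M′ , refl , d′ = lam M′ , refl , plam d′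
⇛β-rename-inversion {M = app M N} (papp d e) refl
  with ⇛β-rename-inversion d refl | ⇛β-rename-inversion e refl
... | M′ , refl , d′ | N′ , refl , e′ = app M′ N′ , refl , papp d′ e′
⇛β-rename-inversion {ρ} {M = app (lam M) N} (pbeta d e) refl
  with ⇛β-rename-inversion d refl | ⇛β-rename-inversion e refl
... | M′ , refl , d′ | N′ , refl , e′ = M′ [ N′ ] , ≡.sym (rename-[] ρ M′ N′) , pbeta d′ e′

⇛β-weakened : ∀ {K P} → rename suc K ⇛β P →
              ∃[ K′ ] K ⇛β K′ × app P (var zero) ≡ app (rename suc K′) (var zero)
⇛β-weakened d with ⇛β-rename-inversion d refl
... | K′ , refl , g = K′ , g , refl

⇛β-η-body-inversion : ∀ K {P} → app (rename suc K) (var zero) ⇛β P →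
  (∃[ K′ ] K ⇛β K′ × P ≡ app (rename suc K′) (var zero)) ⊎
  (∃[ K₀ ] ∃[ K₀′ ] K ≡ lam K₀ × K₀ ⇛β K₀′ × P ≡ K₀′)
-- K is split only so that Agda can see whether rename suc K is a λ, i.e. whether pbeta applies.
⇛β-η-body-inversion (var n)   (papp d pvar) = inj₁ (⇛β-weakened d)
⇛β-η-body-inversion (app K L) (papp d pvar) = inj₁ (⇛β-weakened d)
⇛β-η-body-inversion (lam K)   (papp d pvar) = inj₁ (⇛β-weakened d)
⇛β-η-body-inversion (lam K)   (pbeta d pvar) with ⇛β-rename-inversion d refl
... | K′ , refl , g = inj₂ (K , K′ , refl , g , rename-ext-suc-[var0] K′)

-- The η-rule is stated with equations so that matching on it never has to unify with rename.
infix 4 _⇛η_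
data _⇛η_ : Λ → Λ → Set where
  evar : ∀ {n} → var n ⇛η var n
  elam : ∀ {M M′} → M ⇛η M′ → lam M ⇛η lam M′
  eapp : ∀ {M M′ N N′} → M ⇛η M′ → N ⇛η N′ → app M N ⇛η app M′ N′
  eeta : ∀ {K K′ N V} → N ≡ rename suc K → V ≡ var zero → K ⇛η K′ → lam (app N V) ⇛η K′

⇛η-refl : ∀ M → M ⇛η M
⇛η-refl (var n)   = evar
⇛η-refl (app M N) = eapp (⇛η-refl M) (⇛η-refl N)
⇛η-refl (lam M)   = elam (⇛η-refl M)

⇛η-rename : ∀ ρ {M M′} → M ⇛η M′ → rename ρ M ⇛η rename ρ M′
⇛η-rename ρ evar       = evar
⇛η-rename ρ (elam d)   = elam (⇛η-rename (ext ρ) d)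
⇛η-rename ρ (eapp d e) = eapp (⇛η-rename ρ d) (⇛η-rename ρ e)
⇛η-rename ρ (eeta {K = K} refl refl d) = eeta (rename-weaken ρ K) refl (⇛η-rename ρ d)

⇛η-exts : ∀ {σ τ} → (∀ n → σ n ⇛η τ n) → ∀ n → exts σ n ⇛η exts τ n
⇛η-exts h zero    = evar
⇛η-exts h (suc n) = ⇛η-rename suc (h n)

⇛η-sub : ∀ {σ τ} → (∀ n → σ n ⇛η τ n) → ∀ {M M′} → M ⇛η M′ → sub σ M ⇛η sub τ M′
⇛η-sub h evar       = h _
⇛η-sub h (elam d)   = elam (⇛η-sub (⇛η-exts h) d)
⇛η-sub h (eapp d e) = eapp (⇛η-sub h d) (⇛η-sub h e)
⇛η-sub {σ} h (eeta {K = K} refl refl d) = eeta (sub-weaken σ K) refl (⇛η-sub h d)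

⇛η-[] : ∀ {M M′ N N′} → M ⇛η M′ → N ⇛η N′ → M [ N ] ⇛η M′ [ N′ ]
⇛η-[] d e = ⇛η-sub (λ { zero → e ; (suc n) → evar }) d

rename-ext-var0 : ∀ ρ M → rename (ext ρ) M ≡ var zero → M ≡ var zero
rename-ext-var0 ρ (var zero) e = refl

⇛η-rename-inversion : ∀ {ρ M N P} → N ⇛η P → N ≡ rename ρ M →
                      ∃[ M′ ] P ≡ rename ρ M′ × M ⇛η M′
⇛η-rename-inversion {M = var n} evar refl = var n , refl , evar
⇛η-rename-inversion {M = lam M} (elam d) refl with ⇛η-rename-inversion d refl
... | M′ , refl , d′ = lam M′ , refl , elam d′
⇛η-rename-inversion {M = app M N} (eapp d e) refl
  with ⇛η-rename-inversion d refl | ⇛η-rename-inversion e refl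
... | M′ , refl , d′ | N′ , refl , e′ = app M′ N′ , refl , eapp d′ e′
⇛η-rename-inversion {ρ} {M = lam (app M N)} (eeta {K = K} e v d) refl
  with rename-ext-var0 ρ N v | rename-pullback zero ρ M K e
... | refl | M′ , refl , refl with ⇛η-rename-inversion d refl
... | P′ , refl , d′ = P′ , refl , eeta refl refl d′

⇛η-diamond : ∀ {M P Q} → M ⇛η P → M ⇛η Q → ∃[ R ] P ⇛η R × Q ⇛η R
⇛η-diamond evar evar = _ , evar , evar
⇛η-diamond (elam d) (elam d′) with ⇛η-diamond d d′
... | R , a , b = lam R , elam a , elam b
⇛η-diamond (eapp d e) (eapp d′ e′) with ⇛η-diamond d d′ | ⇛η-diamond e e′
... | R , a , b | S , c , f = app R S , eapp a c , eapp b f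
⇛η-diamond (elam (eapp dN evar)) (eeta refl refl dK) with ⇛η-rename-inversion dN refl
... | K′ , refl , _ with ⇛η-diamond dN (⇛η-rename suc dK)
... | R′ , a , b with ⇛η-rename-inversion b refl
... | R , refl , c with ⇛η-rename-inversion a refl
... | R″ , e , f with rename-suc-injective e
... | refl = R , eeta refl refl f , c
⇛η-diamond (eeta refl refl dK) (elam (eapp dN evar)) with ⇛η-rename-inversion dN refl
... | K′ , refl , f with ⇛η-diamond dK f
... | R , a , b = R , a , eeta refl refl b
⇛η-diamond (eeta refl refl dK) (eeta e′ refl dK′) with rename-suc-injective e′
... | refl = ⇛η-diamond dK dK′

mutual
  ⇛η-⇛β-commute : ∀ {M Q P} → M ⇛η Q → M ⇛β P → ∃[ R ] Q ⇛β R × P ⇛η R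
  ⇛η-⇛β-commute evar pvar = _ , pvar , evar
  ⇛η-⇛β-commute (elam d) (plam d′) with ⇛η-⇛β-commute d d′
  ... | R , a , b = lam R , plam a , elam b
  ⇛η-⇛β-commute (eapp d e) (papp d′ e′) with ⇛η-⇛β-commute d d′ | ⇛η-⇛β-commute e e′
  ... | R , a , b | S , c , f = app R S , papp a c , eapp b f
  ⇛η-⇛β-commute (eapp d e) (pbeta d′ e′) with ⇛η-⇛β-commute e e′
  ... | S , c , f = ⇛η-⇛β-commute-redex d d′ c f
  ⇛η-⇛β-commute (eeta {K = K} refl refl d) (plam d′) with ⇛β-η-body-inversion K d′
  ... | inj₁ (K′ , g , refl) with ⇛η-⇛β-commute d g
  ...   | R , a , b = R , a , eeta refl refl b
  ⇛η-⇛β-commute (eeta refl refl d) (plam d′)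
      | inj₂ (K₀ , K₀′ , refl , g , refl) = ⇛η-⇛β-commute d (plam g)

  ⇛η-⇛β-commute-redex : ∀ {A A′ Q₁ Q₂ N′ S} → lam A ⇛η Q₁ → A ⇛β A′ → Q₂ ⇛β S → N′ ⇛η S →
                        ∃[ R ] app Q₁ Q₂ ⇛β R × A′ [ N′ ] ⇛η R
  ⇛η-⇛β-commute-redex (elam dA) d′ c f with ⇛η-⇛β-commute dA d′
  ... | R , a , b = R [ _ ] , pbeta a c , ⇛η-[] b f
  ⇛η-⇛β-commute-redex (eeta {K = K} refl refl dK) d′ c f with ⇛β-η-body-inversion K d′
  ... | inj₁ (K′ , g , refl) with ⇛η-⇛β-commute dK g
  ...   | R , a , b =
    app R _ , papp a c , subst (λ X → app X _ ⇛η app R _) (≡.sym (weaken-[] K′ _)) (eapp b f)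
  ⇛η-⇛β-commute-redex (eeta refl refl dK) d′ c f
      | inj₂ (K₀ , K₀′ , refl , g , refl) = ⇛η-⇛β-commute-redex dK g c f

Diamond : ∀ {A : Set} → Rel A _ → Set
Diamond _⟶_ = ∀ {M P Q} → M ⟶ P → M ⟶ Q → ∃[ R ] P ⟶ R × Q ⟶ R

diamond⇒confluent : ∀ {A : Set} {_⟶_ : Rel A _} → Diamond _⟶_ → Confluent _⟶_
diamond⇒confluent {_⟶_ = _⟶_} ◇ = confluent
  where
  strip : ∀ {M P Q} → M ⟶ P → Star _⟶_ M Q → ∃[ R ] Star _⟶_ P R × Q ⟶ R
  strip s ε = _ , ε , s
  strip s (t ◅ ts) with ◇ s t
  ... | R₁ , a , b with strip b ts
  ... | R , c , d = R , a ◅ c , d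

  confluent : Confluent _⟶_
  confluent ε ts = _ , ts , ε
  confluent (s ◅ ss) ts with strip s ts
  ... | R₁ , a , b with confluent ss a
  ... | R , c , d = R , c , b ◅ d

_⟶βη_ : Rel Λ _
M ⟶βη N = M ⇛β N ⊎ M ⇛η N

_⟶βη*_ : Rel Λ _
_⟶βη*_ = Star _⟶βη_

⟶βη-diamond : Diamond _⟶βη_
⟶βη-diamond {M} (inj₁ a) (inj₁ b) = develop M , inj₁ (⇛β-develop a) , inj₁ (⇛β-develop b)
⟶βη-diamond (inj₁ a) (inj₂ b) with ⇛η-⇛β-commute b a
... | R , x , y = R , inj₂ y , inj₁ x
⟶βη-diamond (inj₂ a) (inj₁ b) with ⇛η-⇛β-commute a b
... | R , x , y = R , inj₁ x , inj₂ y
⟶βη-diamond (inj₂ a) (inj₂ b) with ⇛η-diamond a b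
... | R , x , y = R , inj₂ x , inj₂ y

⟶βη*-app : ∀ {M M′ N N′} → M ⟶βη* M′ → N ⟶βη* N′ → app M N ⟶βη* app M′ N′
⟶βη*-app {M} {M′} {N} {N′} ds es = gmap (λ X → app X N) appˡ ds ◅◅ gmap (app M′) appʳ es
  where
  appˡ : ∀ {X Y} → X ⟶βη Y → app X N ⟶βη app Y N
  appˡ (inj₁ d) = inj₁ (papp d (⇛β-refl N))
  appˡ (inj₂ d) = inj₂ (eapp d (⇛η-refl N))
  appʳ : ∀ {X Y} → X ⟶βη Y → app M′ X ⟶βη app M′ Y
  appʳ (inj₁ d) = inj₁ (papp (⇛β-refl M′) d)
  appʳ (inj₂ d) = inj₂ (eapp (⇛η-refl M′) d)

⟶βη*-lam : ∀ {M M′} → M ⟶βη* M′ → lam M ⟶βη* lam M′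
⟶βη*-lam = gmap lam λ { (inj₁ d) → inj₁ (plam d) ; (inj₂ d) → inj₂ (elam d) }

=βη⇒joinable : ∀ {M N} → M =βη N → ∃[ R ] M ⟶βη* R × N ⟶βη* R
=βη⇒joinable (β M N) = _ , inj₁ (pbeta (⇛β-refl M) (⇛β-refl N)) ◅ ε , ε
=βη⇒joinable (η M)   = _ , inj₂ (eeta refl refl (⇛η-refl M)) ◅ ε , ε
=βη⇒joinable refl    = _ , ε , ε
=βη⇒joinable (sym h) with =βη⇒joinable h
... | R , a , b = R , b , a
=βη⇒joinable (trans h k) with =βη⇒joinable h | =βη⇒joinable k
... | R₁ , a , b | R₂ , c , d with diamond⇒confluent ⟶βη-diamond b c
... | R , e , f = R , a ◅◅ e , d ◅◅ f
=βη⇒joinable (appC h k) with =βη⇒joinable h | =βη⇒joinable k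
... | R₁ , a , b | R₂ , c , d = app R₁ R₂ , ⟶βη*-app a c , ⟶βη*-app b d
=βη⇒joinable (lamC h) with =βη⇒joinable h
... | R , a , b = lam R , ⟶βη*-lam a , ⟶βη*-lam b

data Applicative : Λ → Set where
  var : ∀ {n} → Applicative (var n)
  app : ∀ {M N} → Applicative M → Applicative N → Applicative (app M N)

applicative-⟶βη : ∀ {M P} → Applicative M → M ⟶βη P → P ≡ M
applicative-⟶βη var         (inj₁ pvar)       = refl
applicative-⟶βη (app a a′) (inj₁ (papp d e)) =
  cong₂ app (applicative-⟶βη a (inj₁ d)) (applicative-⟶βη a′ (inj₁ e))
applicative-⟶βη var         (inj₂ evar)       = refl
applicative-⟶βη (app a a′) (inj₂ (eapp d e)) =
  cong₂ app (applicative-⟶βη a (inj₂ d)) (applicative-⟶βη a′ (inj₂ e))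

applicative-⟶βη* : ∀ {M P} → Applicative M → M ⟶βη* P → P ≡ M
applicative-⟶βη* a ε = refl
applicative-⟶βη* a (s ◅ ss) with applicative-⟶βη a s
... | refl = applicative-⟶βη* a ss

applicative-=βη⇒≡ : ∀ {M N} → Applicative M → Applicative N → M =βη N → M ≡ N
applicative-=βη⇒≡ a b h with =βη⇒joinable h
... | R , x , y = ≡.trans (≡.sym (applicative-⟶βη* a x)) (applicative-⟶βη* b y)

-- Soundness

=βη-setoid : Setoid _ _
=βη-setoid = record
  { Carrier       = Λ
  ; _≈_           = _=βη_
  ; isEquivalence = record { refl = refl ; sym = sym ; trans = trans }
  }

module =βη-Reasoning = Relation.Binary.Reasoning.Setoid =βη-setoid

β≡ : ∀ M N {P} → M [ N ] ≡ P → app (lam M) N =βη P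
β≡ M N refl = β M N

Bλ-β : ∀ M N P → app (app (app Bλ M) N) P =βη app M (app N P)
Bλ-β M N P = begin
  app (app (app Bλ M) N) P                                           ≈⟨ appC (appC (β _ M) refl) refl ⟩
  app (app (lam (lam (app (rename suc (rename suc M)) (app (var 1) (var 0))))) N) P ≈⟨ appC (β _ N) refl ⟩
  app (lam (app (sub (exts (sub0 N)) (rename suc (rename suc M))) (app (rename suc N) (var 0)))) P
    ≈⟨ β≡ _ P (cong₂ app (≡.trans (cong (_[ P ]) (sub-weaken (sub0 N) (rename suc M)))
                         (≡.trans (weaken-[] _ P) (weaken-[] M N)))
                         (cong₂ app (weaken-[] N P) refl)) ⟩
  app M (app N P) ∎
  where open =βη-Reasoning

=βη-ext : ∀ {M N} → app (rename suc M) (var zero) =βη app (rename suc N) (var zero) → M =βη N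
=βη-ext {M} {N} h = trans (sym (η M)) (trans (lamC h) (η N))

applyVars : ℕ → Λ → Λ
applyVars zero    M = M
applyVars (suc k) M = app (rename suc (applyVars k M)) (var zero)

=βη-extⁿ : ∀ k {M N} → applyVars k M =βη applyVars k N → M =βη N
=βη-extⁿ zero    h = h
=βη-extⁿ (suc k) h = =βη-extⁿ k (=βη-ext h)

sound : ∀ {t u} → ⊢B t ≐ u → t ≈βη u
-- (B2) and (B3) are checked on fresh variables, under which ⟦ x ⟧ appears weakened.
sound (B1 x y z) = Bλ-β ⟦ x ⟧ ⟦ y ⟧ ⟦ z ⟧
sound (B2 x y)   = =βη-extⁿ 2 (begin
  app (app (app Bλ (app (app Bλ X) Y)) (var 1)) (var 0)    ≈⟨ Bλ-β _ _ _ ⟩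
  app (app (app Bλ X) Y) (app (var 1) (var 0))              ≈⟨ Bλ-β _ _ _ ⟩
  app X (app Y (app (var 1) (var 0)))                       ≈⟨ appC refl (Bλ-β _ _ _) ⟨
  app X (app (app (app Bλ Y) (var 1)) (var 0))              ≈⟨ Bλ-β _ _ _ ⟨
  app (app (app Bλ X) (app (app Bλ Y) (var 1))) (var 0)     ≈⟨ appC (Bλ-β _ _ _) refl ⟨
  app (app (app (app Bλ (app Bλ X)) (app Bλ Y)) (var 1)) (var 0) ∎)
  where
  open =βη-Reasoning
  X Y : Λ
  X = rename suc (rename suc ⟦ x ⟧)
  Y = rename suc (rename suc ⟦ y ⟧)
sound (B3 x)     = =βη-extⁿ 3 (begin
  app (app (app (app (app Bλ Bλ) (app Bλ X)) (var 2)) (var 1)) (var 0) ≈⟨ appC (appC (Bλ-β _ _ _) refl) refl ⟩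
  app (app (app Bλ (app (app Bλ X) (var 2))) (var 1)) (var 0)      ≈⟨ Bλ-β _ _ _ ⟩
  app (app (app Bλ X) (var 2)) (app (var 1) (var 0))               ≈⟨ Bλ-β _ _ _ ⟩
  app X (app (var 2) (app (var 1) (var 0)))                        ≈⟨ appC refl (Bλ-β _ _ _) ⟨
  app X (app (app (app Bλ (var 2)) (var 1)) (var 0))               ≈⟨ Bλ-β _ _ _ ⟨
  app (app (app Bλ X) (app (app Bλ (var 2)) (var 1))) (var 0)      ≈⟨ appC (Bλ-β _ _ _) refl ⟨
  app (app (app (app Bλ (app Bλ X)) (app Bλ (var 2))) (var 1)) (var 0) ≈⟨ appC (appC (Bλ-β _ _ _) refl) refl ⟨
  app (app (app (app (app Bλ (app Bλ (app Bλ X))) Bλ) (var 2)) (var 1)) (var 0) ∎)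
  where
  open =βη-Reasoning
  X : Λ
  X = rename suc (rename suc (rename suc ⟦ x ⟧))
sound refl        = refl
sound (sym d)     = sym (sound d)
sound (trans d e) = trans (sound d) (sound e)
sound (appC d e)  = appC (sound d) (sound e)

-- Normal forms of B-terms

B[_] : ℕ → BTerm
B[ zero ]  = B
B[ suc n ] = B · B[ n ]

-- ⟪ a₁ ◂ … ◂ one aₙ ⟫ is the composite B[ aₙ ] ∘ … ∘ B[ a₁ ], reading B · f · g as f ∘ g.
infixr 5 _◂_
data Word : Set where
  one : ℕ → Word
  _◂_ : ℕ → Word → Word

⟪_⟫ : Word → BTerm
⟪ one a ⟫ = B[ a ]
⟪ a ◂ w ⟫ = B · ⟪ w ⟫ · B[ a ]

≐-assoc : ∀ x y z → ⊢B B · (B · x · y) · z ≐ B · x · (B · y · z)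
≐-assoc x y z = trans (appC (B2 x y) refl) (B1 (B · x) (B · y) z)

shift : Word → Word
shift (one a) = one (suc a)
shift (a ◂ w) = suc a ◂ shift w

≐-shift : ∀ w → ⊢B B · ⟪ w ⟫ ≐ ⟪ shift w ⟫
≐-shift (one a) = refl
≐-shift (a ◂ w) = trans (B2 ⟪ w ⟫ B[ a ]) (appC (appC refl (≐-shift w)) refl)

snoc : Word → ℕ → Word
snoc (one a) n = a ◂ one n
snoc (a ◂ w) n = a ◂ snoc w n

≐-snoc : ∀ n w → ⊢B B · B[ n ] · ⟪ w ⟫ ≐ ⟪ snoc w n ⟫
≐-snoc n (one a) = refl
≐-snoc n (a ◂ w) = trans (sym (≐-assoc B[ n ] ⟪ w ⟫ B[ a ])) (appC (appC refl (≐-snoc n w)) refl)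

act : ℕ → Word → Word
act zero    w = shift w
act (suc n) w = snoc w n

≐-act : ∀ a w → ⊢B B[ a ] · ⟪ w ⟫ ≐ ⟪ act a w ⟫
≐-act zero    w = ≐-shift w
≐-act (suc n) w = ≐-snoc n w

compose : Word → Word → Word
compose (one a) w = act a w
compose (a ◂ v) w = compose v (act a w)

≐-compose : ∀ v w → ⊢B ⟪ v ⟫ · ⟪ w ⟫ ≐ ⟪ compose v w ⟫
≐-compose (one a) w = ≐-act a w
≐-compose (a ◂ v) w =
  trans (B1 ⟪ v ⟫ B[ a ] ⟪ w ⟫) (trans (appC refl (≐-act a w)) (≐-compose v (act a w)))

word : BTerm → Word
word B       = one zero
word (t · u) = compose (word t) (word u)

≐-word : ∀ t → ⊢B t ≐ ⟪ word t ⟫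
≐-word B       = refl
≐-word (t · u) = trans (appC (≐-word t) (≐-word u)) (≐-compose (word t) (word u))

-- Thompson's relation: it lets insert move smaller indices to the front.
≐-swap : ∀ {i j} → i < j → ⊢B B · B[ i ] · B[ j ] ≐ B · B[ suc j ] · B[ i ]
≐-swap {zero}  {suc j} _         = B3 B[ j ]
≐-swap {suc i} {suc j} (s≤s i<j) =
  trans (sym (B2 B[ i ] B[ j ])) (trans (appC refl (≐-swap i<j)) (B2 B[ suc j ] B[ i ]))

insert : ℕ → Word → Word
insert a (one c) with c <? a
... | yes _ = c ◂ one (suc a)
... | no  _ = a ◂ one c
insert a (c ◂ w) with c <? a
... | yes _ = c ◂ insert (suc a) w
... | no  _ = a ◂ c ◂ w

≐-insert : ∀ a w → ⊢B B · ⟪ w ⟫ · B[ a ] ≐ ⟪ insert a w ⟫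
≐-insert a (one c) with c <? a
... | yes c<a = ≐-swap c<a
... | no  _   = refl
≐-insert a (c ◂ w) with c <? a
... | yes c<a = trans (≐-assoc ⟪ w ⟫ B[ c ] B[ a ]) (trans (appC refl (≐-swap c<a))
                  (trans (sym (≐-assoc ⟪ w ⟫ B[ suc a ] B[ c ])) (appC (appC refl (≐-insert (suc a) w)) refl)))
... | no  _   = refl

sort : Word → Word
sort (one a) = one a
sort (a ◂ w) = insert a (sort w)

≐-sort : ∀ w → ⊢B ⟪ w ⟫ ≐ ⟪ sort w ⟫
≐-sort (one a) = refl
≐-sort (a ◂ w) = trans (appC (appC refl (≐-sort w)) refl) (≐-insert a (sort w))

normalForm : BTerm → Word
normalForm t = sort (word t)

≐-normalForm : ∀ t → ⊢B t ≐ ⟪ normalForm t ⟫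
≐-normalForm t = trans (≐-word t) (≐-sort (word t))

indices : Word → List ℕ
indices (one a) = a ∷ []
indices (a ◂ w) = a ∷ indices w

Sorted : Word → Set
Sorted w = AllPairs _≤_ (indices w)

insert-All : ∀ (P : ℕ → Set) → (∀ {x} → P x → P (suc x)) →
             ∀ a w → P a → All P (indices w) → All P (indices (insert a w))
insert-All P up a (one c) pa (pc ∷ []) with c <? a
... | yes _ = pc ∷ up pa ∷ []
... | no  _ = pa ∷ pc ∷ []
insert-All P up a (c ◂ w) pa (pc ∷ pw) with c <? a
... | yes _ = pc ∷ insert-All P up (suc a) w (up pa) pw
... | no  _ = pa ∷ pc ∷ pw

insert-sorted : ∀ a w → Sorted w → Sorted (insert a w)
insert-sorted a (one c) s with c <? a
... | yes c<a = (m≤n⇒m≤1+n (<⇒≤ c<a) ∷ []) ∷ [] ∷ []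
... | no  c≮a = (≮⇒≥ c≮a ∷ []) ∷ s
insert-sorted a (c ◂ w) (c≤w ∷ s) with c <? a
... | yes c<a = insert-All (c ≤_) m≤n⇒m≤1+n (suc a) w (m≤n⇒m≤1+n (<⇒≤ c<a)) c≤w ∷ insert-sorted (suc a) w s
... | no  c≮a = (≮⇒≥ c≮a ∷ All.map (≤-trans (≮⇒≥ c≮a)) c≤w) ∷ c≤w ∷ s

sort-sorted : ∀ w → Sorted (sort w)
sort-sorted (one a) = [] ∷ []
sort-sorted (a ◂ w) = insert-sorted a (sort w) (sort-sorted w)

-- Separation of sorted words

apps : Λ → List Λ → Λ
apps = foldl app

apps-cong : ∀ {M M′} L → M =βη M′ → apps M L =βη apps M′ L
apps-cong []      h = h
apps-cong (x ∷ L) h = apps-cong L (appC h refl)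

-- merge n replaces the n-th and (n+1)-st entries by their application;
-- it does nothing on too short lists, which Executable rules out.
merge : ℕ → List Λ → List Λ
merge zero    (x ∷ y ∷ L) = app x y ∷ L
merge zero    L           = L
merge (suc n) (x ∷ L)     = x ∷ merge n L
merge (suc n) []          = []

run : List ℕ → List Λ → List Λ
run []      L = L
run (a ∷ r) L = merge a (run r L)

Executable : List ℕ → List Λ → Set
Executable []      L = ⊤
Executable (a ∷ r) L = Executable r L × a + 2 ≤ length (run r L)

B[]-action : ∀ n X L → n + 2 ≤ length L → apps (app ⟦ B[ n ] ⟧ X) L =βη apps X (merge n L)
B[]-action zero    X (y ∷ z ∷ L) _       = apps-cong L (Bλ-β X y z)
B[]-action zero    X (y ∷ [])    (s≤s ())
B[]-action (suc n) X (y ∷ L)     (s≤s p) =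
  trans (apps-cong L (Bλ-β ⟦ B[ n ] ⟧ X y)) (B[]-action n (app X y) L p)

word-action : ∀ w X L → Executable (indices w) L → apps (app ⟦ ⟪ w ⟫ ⟧ X) L =βη apps X (run (indices w) L)
word-action (one a) X L (_ , p)  = B[]-action a X L p
word-action (a ◂ w) X L (ex , p) = trans (apps-cong L (Bλ-β ⟦ ⟪ w ⟫ ⟧ ⟦ B[ a ] ⟧ X))
  (trans (word-action w (app ⟦ B[ a ] ⟧ X) L ex) (B[]-action a X _ p))

weight : List ℕ → ℕ
weight []      = 0
weight (a ∷ r) = weight r + (a + 2)

length-merge : ∀ a L → a + 2 ≤ length L → suc (length (merge a L)) ≡ length L
length-merge zero    (x ∷ y ∷ L) p       = refl
length-merge zero    (x ∷ [])    (s≤s ())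
length-merge (suc a) (x ∷ L)     (s≤s p) = cong suc (length-merge a L p)

weight-executable : ∀ r L k → weight r + k ≤ length L → Executable r L × k ≤ length (run r L)
weight-executable []      L k p = tt , p
weight-executable (a ∷ r) L k p
  with weight-executable r L (a + 2 + k) (subst (_≤ length L) (+-assoc (weight r) (a + 2) k) p)
... | ex , q = (ex , a+2≤) , ≤-pred (begin
    suc k                       ≤⟨ +-monoˡ-≤ k (≤-trans (s≤s z≤n) (m≤n+m 2 a)) ⟩
    a + 2 + k                   ≤⟨ q ⟩
    length (run r L)            ≡⟨ length-merge a (run r L) a+2≤ ⟨
    suc (length (run (a ∷ r) L)) ∎)
  where
  open ≤-Reasoning
  a+2≤ : a + 2 ≤ length (run r L)
  a+2≤ = m+n≤o⇒m≤o (a + 2) q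

IsVar : Λ → Set
IsVar M = ∃[ n ] M ≡ var n

take-merge : ∀ k a L → k ≤ a → take k (merge a L) ≡ take k L
take-merge zero    a       L       _       = refl
take-merge (suc k) (suc a) (x ∷ L) (s≤s p) = cong (x ∷_) (take-merge k a L p)
take-merge (suc k) (suc a) []      (s≤s p) = refl

take-run : ∀ k r L → All (k ≤_) r → take k (run r L) ≡ take k L
take-run k []      L []       = refl
take-run k (a ∷ r) L (p ∷ ps) = ≡.trans (take-merge k a (run r L) p) (take-run k r L ps)

merge-creates-app : ∀ a L → a + 2 ≤ length L → ¬ All IsVar (take (suc a) (merge a L))
merge-creates-app zero    (x ∷ y ∷ L) _       ((_ , ()) ∷ _)
merge-creates-app zero    (x ∷ [])    (s≤s ())
merge-creates-app (suc a) (x ∷ L)     (s≤s p) (_ ∷ vs) = merge-creates-app a L p vs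

merge-injective : ∀ a L L′ → a + 2 ≤ length L → a + 2 ≤ length L′ → merge a L ≡ merge a L′ → L ≡ L′
merge-injective zero    (x ∷ y ∷ L) (x′ ∷ y′ ∷ L′) _ _ e with ∷-injective e
... | e₁ , refl with app-injective e₁
... | refl , refl = refl
merge-injective zero    (x ∷ [])    L′       (s≤s ()) _ _
merge-injective zero    L           (x′ ∷ []) _ (s≤s ()) _
merge-injective (suc a) (x ∷ L)     (x′ ∷ L′) (s≤s p) (s≤s p′) e with ∷-injective e
... | refl , e₂ = cong (x ∷_) (merge-injective a L L′ p p′ e₂)

run-creates-app : ∀ a r L → Executable (a ∷ r) L → ¬ All IsVar (take (suc a) (run (a ∷ r) L))
run-creates-app a r L (_ , p) = merge-creates-app a (run r L) p

run-keeps-vars : ∀ a r L → All (suc a ≤_) r → All IsVar L → All IsVar (take (suc a) (run r L))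
run-keeps-vars a r L above vs = subst (All IsVar) (≡.sym (take-run (suc a) r L above)) (take⁺ (suc a) vs)

-- If the first merges differ, a < a′ say, then only the left side has an application
-- among its first a + 1 entries.
run-injective : ∀ r r′ L → AllPairs _≤_ r → AllPairs _≤_ r′ → Executable r L → Executable r′ L →
                All IsVar L → run r L ≡ run r′ L → r ≡ r′
run-injective []      []       L _ _ _ _ _ _ = refl
run-injective []      (a ∷ r′) L _ _ _ ex′ vs e =
  ⊥-elim (run-creates-app a r′ L ex′ (subst (All IsVar ∘ take (suc a)) e (take⁺ (suc a) vs)))
run-injective (a ∷ r) []       L _ _ ex _ vs e =
  ⊥-elim (run-creates-app a r L ex (subst (All IsVar ∘ take (suc a)) (≡.sym e) (take⁺ (suc a) vs)))
run-injective (a ∷ r) (a′ ∷ r′) L (a≤r ∷ s) (a′≤r′ ∷ s′) ex ex′ vs e with <-cmp a a′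
... | tri< a<a′ _ _ = ⊥-elim (run-creates-app a r L ex (subst (All IsVar ∘ take (suc a)) (≡.sym e)
                        (run-keeps-vars a (a′ ∷ r′) L (a<a′ ∷ All.map (≤-trans a<a′) a′≤r′) vs)))
... | tri> _ _ a′<a = ⊥-elim (run-creates-app a′ r′ L ex′ (subst (All IsVar ∘ take (suc a′)) e
                        (run-keeps-vars a′ (a ∷ r) L (a′<a ∷ All.map (≤-trans a′<a) a≤r) vs)))
... | tri≈ _ refl _ = cong (a ∷_) (run-injective r r′ L s s′ (proj₁ ex) (proj₁ ex′) vs
                        (merge-injective a (run r L) (run r′ L) (proj₂ ex) (proj₂ ex′) e))

indices-injective : ∀ w w′ → indices w ≡ indices w′ → w ≡ w′
indices-injective (one a) (one a′)  refl = refl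
indices-injective (one a) (_ ◂ one _) ()
indices-injective (one a) (_ ◂ _ ◂ _) ()
indices-injective (_ ◂ one _) (one a) ()
indices-injective (_ ◂ _ ◂ _) (one a) ()
indices-injective (a ◂ w) (a′ ◂ w′) e with ∷-injective e
... | refl , e₂ = cong (a ◂_) (indices-injective w w′ e₂)

merge-applicative : ∀ a L → All Applicative L → All Applicative (merge a L)
merge-applicative zero    (x ∷ y ∷ L) (px ∷ py ∷ ps) = app px py ∷ ps
merge-applicative zero    []          ps             = ps
merge-applicative zero    (x ∷ [])    ps             = ps
merge-applicative (suc a) (x ∷ L)     (px ∷ ps)      = px ∷ merge-applicative a L ps
merge-applicative (suc a) []          ps             = ps

run-applicative : ∀ r L → All Applicative L → All Applicative (run r L)
run-applicative []      L ps = ps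
run-applicative (a ∷ r) L ps = merge-applicative a (run r L) (run-applicative r L ps)

apps-applicative : ∀ {M} K → Applicative M → All Applicative K → Applicative (apps M K)
apps-applicative []      a []        = a
apps-applicative (x ∷ K) a (px ∷ ps) = apps-applicative K (app a px) ps

spine : Λ → ℕ
spine (app M N) = suc (spine M)
spine _         = 0

spine-apps : ∀ M K → spine (apps M K) ≡ spine M + length K
spine-apps M []      = ≡.sym (+-identityʳ (spine M))
spine-apps M (x ∷ K) = ≡.trans (spine-apps (app M x) K) (≡.sym (+-suc (spine M) (length K)))

apps-injective : ∀ {M M′} K K′ → spine M ≡ spine M′ → apps M K ≡ apps M′ K′ → M ≡ M′ × K ≡ K′
apps-injective []      []        _ e = e , refl
apps-injective {M} {M′} [] (y ∷ K′) s e =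
  ⊥-elim (m≢1+m+n (spine M′) (≡.trans (≡.sym s) (≡.trans (cong spine e) (spine-apps (app M′ y) K′))))
apps-injective {M} {M′} (x ∷ K) [] s e =
  ⊥-elim (m≢1+m+n (spine M) (≡.trans s (≡.trans (cong spine (≡.sym e)) (spine-apps (app M x) K))))
apps-injective (x ∷ K) (y ∷ K′) s e with apps-injective K K′ (cong suc s) e
... | e₁ , refl with app-injective e₁
... | refl , refl = refl , refl

-- Both words act on var zero and enough further copies of var zero; the two resulting λ-free
-- terms are βη-equal, hence identical, and run-injective reads the words back from them.
sorted-≈βη⇒≡ : ∀ w w′ → Sorted w → Sorted w′ → ⟪ w ⟫ ≈βη ⟪ w′ ⟫ → w ≡ w′
sorted-≈βη⇒≡ w w′ s s′ h = indices-injective w w′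
  (run-injective r r′ L s s′ ex ex′ (replicate⁺ N (zero , refl)) same-arguments)
  where
  r r′ : List ℕ
  r  = indices w
  r′ = indices w′
  N : ℕ
  N = weight r + weight r′
  L : List Λ
  L = replicate N (var zero)
  executable : ∀ r → weight r ≤ N → Executable r L
  executable r p =
    proj₁ (weight-executable r L 0
             (subst₂ _≤_ (≡.sym (+-identityʳ (weight r))) (≡.sym (length-replicate N)) p))
  ex : Executable r L
  ex = executable r (m≤m+n (weight r) (weight r′))
  ex′ : Executable r′ L
  ex′ = executable r′ (m≤n+m (weight r′) (weight r))
  applicative : ∀ r → Applicative (apps (var zero) (run r L))
  applicative r = apps-applicative (run r L) var (run-applicative r L (replicate⁺ N var))
  same-arguments : run r L ≡ run r′ L
  same-arguments = proj₂ (apps-injective (run r L) (run r′ L) refl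
    (applicative-=βη⇒≡ (applicative r) (applicative r′)
      (trans (sym (word-action w (var zero) L ex))
        (trans (apps-cong L (appC h refl)) (word-action w′ (var zero) L ex′)))))

complete : ∀ {t u} → t ≈βη u → ⊢B t ≐ u
complete {t} {u} h =
  trans (≐-normalForm t) (subst (λ w → ⊢B ⟪ w ⟫ ≐ u) (≡.sym same-normal-form) (sym (≐-normalForm u)))
  where
  same-normal-form : normalForm t ≡ normalForm u
  same-normal-form = sorted-≈βη⇒≡ (normalForm t) (normalForm u) (sort-sorted (word t)) (sort-sorted (word u))
    (trans (sym (sound (≐-normalForm t))) (trans h (sound (≐-normalForm u))))

theorem2p1 : ∀ (t u : BTerm) → (t ≈βη u) ⇔ (⊢B t ≐ u)
theorem2p1 t u = mk⇔ complete sound
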